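{- For all graphs $G$ and $H$, $$\operatorname{tw}(G\boxtimes H)\geq \eta(H)\,(\operatorname{tw}(G)+1)-1.$$
   Context: All graphs are finite and simple. $\operatorname{tw}$ denotes treewidth. The Hadwiger number $\eta(H)$ is the maximum integer $t$ such that $K_t$ is a minor of $H$. The strong product $G\boxtimes H$ has vertex set $V(G)\times V(H)$, with distinct $(a,v),(b,u)$ adjacent iff ($a=b$ or $ab\in E(G)$) and ($u=v$ or $uv\in E(H)$). -}

module Defs where

open import Data.Nat using (ℕ; zero; suc; _+_; _*_; _≤_)
open import Data.Fin using (Fin; zero; suc; inject₁; fromℕ; remQuot)
open import Data.Fin.Subset using (Subset; _∈_; ∣_∣)
open import Data.Product using (Σ; ∃; _×_; _,_; proj₁; proj₂)
open import Data.Sum using (_⊎_; inj₁; inj₂)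
open import Data.Unit using (⊤)
open import Data.Empty using (⊥)
open import Relation.Nullary using (¬_)
open import Relation.Binary.PropositionalEquality using (_≡_; _≢_; refl; sym)
open import Function.Definitions using (Injective)

record Graph : Set₁ where
  field
    n     : ℕ
    E     : Fin n → Fin n → Set
    E-sym : ∀ {x y} → E x y → E y x
    E-irr : ∀ {x} → ¬ E x x
open Graph public

module _ (G : Graph) where
  data WalkIn (S : Fin (n G) → Set) : Fin (n G) → Fin (n G) → Set where
    here  : ∀ {x} → S x → WalkIn S x x
    step  : ∀ {x y z} → S x → E G x y → WalkIn S y z → WalkIn S x z

  ConnectedSet : (Fin (n G) → Set) → Set
  ConnectedSet S = ∀ x y → S x → S y → WalkIn S x y

  Connected : Set
  Connected = ConnectedSet (λ _ → ⊤)

  -- A cycle of length k+3: distinct vertices c 0, …, c (k+2), consecutive ones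
  -- adjacent and c (k+2) adjacent to c 0.
  Cycle : Set
  Cycle = Σ ℕ λ k → Σ (Fin (suc (suc (suc k))) → Fin (n G)) λ c →
            Injective _≡_ _≡_ c
          × (∀ (i : Fin (suc (suc k))) → E G (c (inject₁ i)) (c (suc i)))
          × E G (c (fromℕ (suc (suc k)))) (c zero)

  Acyclic : Set
  Acyclic = ¬ Cycle

IsTree : Graph → Set
IsTree T = (Σ ℕ λ m → n T ≡ suc m) × Connected T × Acyclic T

-- A tree decomposition of G in which every bag has at most b vertices
-- (i.e. of width at most b - 1).
record TreeDecomposition (G : Graph) (b : ℕ) : Set₁ where
  field
    T        : Graph
    T-tree   : IsTree T
    bag      : Fin (n T) → Subset (n G)
    covers-V : ∀ v → Σ (Fin (n T)) λ x → v ∈ bag x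
    covers-E : ∀ u v → E G u v → Σ (Fin (n T)) λ x → (u ∈ bag x) × (v ∈ bag x)
    conn     : ∀ v → ConnectedSet T (λ x → v ∈ bag x)
    bag-size : ∀ x → ∣ bag x ∣ ≤ b

-- tw G + 1 ≡ s : s is the minimum bag size bound over all tree decompositions.
-- (Using tw + 1 avoids the convention tw(empty graph) = -1.)
IsTreewidthPlusOne : Graph → ℕ → Set₁
IsTreewidthPlusOne G s =
  TreeDecomposition G s × (∀ b → TreeDecomposition G b → s ≤ b)

record KMinorModel (t : ℕ) (H : Graph) : Set where
  field
    branch    : Fin t → Subset (n H)
    nonempty  : ∀ i → Σ (Fin (n H)) λ v → v ∈ branch i
    connected : ∀ i → ConnectedSet H (λ v → v ∈ branch i)
    disjoint  : ∀ i j → i ≢ j → ∀ v → v ∈ branch i → v ∈ branch j → ⊥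
    adjacent  : ∀ i j → i ≢ j →
                Σ (Fin (n H)) λ u → Σ (Fin (n H)) λ v →
                  (u ∈ branch i) × (v ∈ branch j) × E H u v

HasKMinor : ℕ → Graph → Set
HasKMinor t H = KMinorModel t H

IsHadwiger : Graph → ℕ → Set
IsHadwiger H t = HasKMinor t H × (∀ s → HasKMinor s H → s ≤ t)

-- Strong product. Vertex set Fin (n G * n H), identified with Fin (n G) × Fin (n H)
-- via the bijection remQuot / combine.
private
  module SP (G H : Graph) where
    V = Fin (n G * n H)
    fstV : V → Fin (n G)
    fstV i = proj₁ (remQuot {n G} (n H) i)
    sndV : V → Fin (n H)
    sndV i = proj₂ (remQuot {n G} (n H) i)

    Adj : V → V → Set
    Adj i j = i ≢ j
            × (fstV i ≡ fstV j ⊎ E G (fstV i) (fstV j))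
            × (sndV i ≡ sndV j ⊎ E H (sndV i) (sndV j))

    eqOrE-symG : ∀ {a b} → (a ≡ b ⊎ E G a b) → (b ≡ a ⊎ E G b a)
    eqOrE-symG (inj₁ p) = inj₁ (sym p)
    eqOrE-symG (inj₂ e) = inj₂ (E-sym G e)

    eqOrE-symH : ∀ {a b} → (a ≡ b ⊎ E H a b) → (b ≡ a ⊎ E H b a)
    eqOrE-symH (inj₁ p) = inj₁ (sym p)
    eqOrE-symH (inj₂ e) = inj₂ (E-sym H e)

    Adj-sym : ∀ {i j} → Adj i j → Adj j i
    Adj-sym (ne , p , q) = (λ e → ne (sym e)) , eqOrE-symG p , eqOrE-symH q

    Adj-irr : ∀ {i} → ¬ Adj i i
    Adj-irr (ne , _ , _) = ne refl

_⊠_ : Graph → Graph → Graph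
G ⊠ H = record
  { n = n G * n H
  ; E = SP.Adj G H
  ; E-sym = SP.Adj-sym G H
  ; E-irr = SP.Adj-irr G H
  }

-- Fix a model B₁, …, B_t of K_t in H and a tree decomposition (T, W) of G ⊠ H, and put a vertex
-- g of G into the new bag at a node x of T when every B_i meets W_x inside the copy {g} × V(H).
-- For fixed g and i the nodes where B_i meets that copy form a subtree of T, because B_i is
-- connected; any two of these subtrees, also for adjacent g and h, intersect because distinct
-- branch sets are adjacent. The Helly property of subtrees of a tree then makes the new bags a
-- tree decomposition of G, and since the B_i are disjoint, a new bag with s vertices forces t·s
-- vertices into the old one.
module Submission where

open import Defs
open import Data.Nat using (ℕ; _*_; _≤_)

module Walks (T : Graph) where

  open import Data.Fin using (Fin; zero; suc; inject₁; fromℕ; _≟_)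
  open import Data.Nat using (suc)
  open import Data.Product using (Σ; _×_; _,_; proj₁; proj₂)
  open import Data.Sum using (_⊎_; inj₁; inj₂)
  open import Data.Unit using (⊤; tt)
  open import Data.Empty using (⊥-elim)
  open import Data.List using (List; []; _∷_)
  open import Data.List.Membership.Propositional using (_∈_; _∉_)
  open import Data.List.Membership.DecPropositional (_≟_ {n T}) using (_∈?_)
  open import Data.List.Relation.Binary.Subset.Propositional using (_⊆_)
  open import Data.List.Relation.Unary.Any using (here; there)
  open import Data.List.Relation.Unary.All as All using (All; []; _∷_)
  open import Function using (_∘_)
  open import Function.Definitions using (Injective)
  open import Relation.Nullary using (yes; no)
  open import Relation.Binary.PropositionalEquality using (_≡_; refl; sym; subst; cong)

  Vertex : Set
  Vertex = Fin (n T)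

  private variable
    a b u v x y z : Vertex
    S S′ : Vertex → Set

  data Walk : Vertex → Vertex → Set where
    nil  : Walk x x
    cons : E T x y → Walk y z → Walk x z

  vertices : Walk x y → List Vertex
  vertices (nil {x}) = x ∷ []
  vertices (cons {x} _ w) = x ∷ vertices w

  IsPath : Walk x y → Set
  IsPath nil = ⊤
  IsPath (cons {x} _ w) = x ∉ vertices w × IsPath w

  data Traverses (u v : Vertex) : Walk x y → Set where
    hit  : (e : E T u v) (w : Walk v z) → Traverses u v (cons e w)
    skip : {e : E T x y} {w : Walk y z} → Traverses u v w → Traverses u v (cons e w)

  _++_ : Walk x y → Walk y z → Walk x z
  nil ++ w′ = w′
  cons e w ++ w′ = cons e (w ++ w′)

  reverse : Walk x y → Walk y x
  reverse nil = nil
  reverse (cons e w) = reverse w ++ cons (E-sym T e) nil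

  traverses-++ : (w : Walk x y) {w′ : Walk y z} →
                 Traverses u v (w ++ w′) → Traverses u v w ⊎ Traverses u v w′
  traverses-++ nil s = inj₂ s
  traverses-++ (cons e w) (hit _ _) = inj₁ (hit e w)
  traverses-++ (cons e w) (skip s) with traverses-++ w s
  ... | inj₁ s′ = inj₁ (skip s′)
  ... | inj₂ s′ = inj₂ s′

  traverses-reverse : (w : Walk x y) → Traverses u v (reverse w) → Traverses v u w
  traverses-reverse (cons e w) s with traverses-++ (reverse w) s
  ... | inj₁ s′ = skip (traverses-reverse w s′)
  ... | inj₂ (hit _ _) = hit e w

  traverses⇒∈ : {w : Walk x y} → Traverses u v w → u ∈ vertices w × v ∈ vertices w
  traverses⇒∈ (hit e nil) = here refl , there (here refl)
  traverses⇒∈ (hit e (cons _ _)) = here refl , there (here refl)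
  traverses⇒∈ (skip s) = there (proj₁ (traverses⇒∈ s)) , there (proj₂ (traverses⇒∈ s))

  traverses-All : {w : Walk x y} → All S (vertices w) → Traverses u v w → S u × S v
  traverses-All all s =
    All.lookup all (proj₁ (traverses⇒∈ s)) , All.lookup all (proj₂ (traverses⇒∈ s))

  fromWalkIn : WalkIn T S x y → Σ (Walk x y) (All S ∘ vertices)
  fromWalkIn (here s) = nil , s ∷ []
  fromWalkIn (step s e w) with fromWalkIn w
  ... | w′ , all = cons e w′ , s ∷ all

  toWalkIn : (w : Walk x y) → All S (vertices w) → WalkIn T S x y
  toWalkIn nil (s ∷ []) = here s
  toWalkIn (cons e w) (s ∷ all) = step s e (toWalkIn w all)

  WalkIn-map : (∀ {x} → S x → S′ x) → WalkIn T S x y → WalkIn T S′ x y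
  WalkIn-map f (here s) = here (f s)
  WalkIn-map f (step s e w) = step (f s) e (WalkIn-map f w)

  _++ᵂ_ : WalkIn T S x y → WalkIn T S y z → WalkIn T S x z
  here _ ++ᵂ w′ = w′
  step s e w ++ᵂ w′ = step s e (w ++ᵂ w′)

  record _⊑_ (p : Walk a b) (w : Walk x y) : Set where
    field
      vertices⊆  : vertices p ⊆ vertices w
      traverses⊆ : Traverses u v p → Traverses u v w
  open _⊑_ public

  ⊑-refl : {w : Walk x y} → w ⊑ w
  ⊑-refl = record { vertices⊆ = λ m → m ; traverses⊆ = λ s → s }

  ⊑-trans : {p : Walk a b} {q : Walk u v} {w : Walk x y} → p ⊑ q → q ⊑ w → p ⊑ w
  ⊑-trans p⊑q q⊑w = record
    { vertices⊆ = vertices⊆ q⊑w ∘ vertices⊆ p⊑q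
    ; traverses⊆ = traverses⊆ q⊑w ∘ traverses⊆ p⊑q }

  ⊑-cons : {p : Walk a b} {w : Walk y z} {e : E T x y} → p ⊑ w → p ⊑ cons e w
  ⊑-cons p⊑w = record
    { vertices⊆ = there ∘ vertices⊆ p⊑w
    ; traverses⊆ = skip ∘ traverses⊆ p⊑w }

  cons-⊑-cons : {p : Walk y a} {w : Walk y z} (e : E T x y) → p ⊑ w → cons e p ⊑ cons e w
  cons-⊑-cons {w = w} e p⊑w = record
    { vertices⊆ = λ { (here eq) → here eq ; (there m) → there (vertices⊆ p⊑w m) }
    ; traverses⊆ = λ { (hit _ _) → hit e w ; (skip s) → skip (traverses⊆ p⊑w s) } }

  suffix : (p : Walk y z) → IsPath p → a ∈ vertices p → Σ (Walk a z) λ q → IsPath q × q ⊑ p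
  suffix nil _ (here refl) = nil , tt , ⊑-refl
  suffix (cons e p) p-path (here refl) = cons e p , p-path , ⊑-refl
  suffix (cons e p) (_ , p-path) (there m) with suffix p p-path m
  ... | q , q-path , q⊑p = q , q-path , ⊑-cons q⊑p

  eraseLoops : (w : Walk x y) → Σ (Walk x y) λ p → IsPath p × p ⊑ w
  eraseLoops nil = nil , tt , ⊑-refl
  eraseLoops (cons {x} e w) with eraseLoops w
  ... | p , p-path , p⊑w with x ∈? vertices p
  ...   | yes x∈p = let q , q-path , q⊑p = suffix p p-path x∈p
                    in q , q-path , ⊑-cons (⊑-trans q⊑p p⊑w)
  ...   | no x∉p = cons e p , (x∉p , p-path) , cons-⊑-cons e p⊑w

  length : Walk x y → ℕ
  length nil = 0
  length (cons _ w) = suc (length w)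

  vertexAt : (w : Walk x y) → Fin (suc (length w)) → Vertex
  vertexAt {x} w zero = x
  vertexAt (cons _ w) (suc i) = vertexAt w i

  vertexAt-∈ : (w : Walk x y) (i : Fin (suc (length w))) → vertexAt w i ∈ vertices w
  vertexAt-∈ nil zero = here refl
  vertexAt-∈ (cons _ _) zero = here refl
  vertexAt-∈ (cons _ w) (suc i) = there (vertexAt-∈ w i)

  vertexAt-injective : (w : Walk x y) → IsPath w → Injective _≡_ _≡_ (vertexAt w)
  vertexAt-injective nil _ {zero} {zero} _ = refl
  vertexAt-injective (cons _ _) _ {zero} {zero} _ = refl
  vertexAt-injective (cons _ w) (x∉w , _) {zero} {suc j} eq =
    ⊥-elim (x∉w (subst (_∈ vertices w) (sym eq) (vertexAt-∈ w j)))
  vertexAt-injective (cons _ w) (x∉w , _) {suc i} {zero} eq =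
    ⊥-elim (x∉w (subst (_∈ vertices w) eq (vertexAt-∈ w i)))
  vertexAt-injective (cons _ w) (_ , w-path) {suc i} {suc j} eq =
    cong suc (vertexAt-injective w w-path eq)

  vertexAt-edge : (w : Walk x y) (i : Fin (length w)) →
                  E T (vertexAt w (inject₁ i)) (vertexAt w (suc i))
  vertexAt-edge (cons e _) zero = e
  vertexAt-edge (cons _ w) (suc i) = vertexAt-edge w i

  vertexAt-last : (w : Walk x y) → vertexAt w (fromℕ (length w)) ≡ y
  vertexAt-last nil = refl
  vertexAt-last (cons _ w) = vertexAt-last w

  closedPath⇒cycle : (e₁ : E T x y) (e₂ : E T y z) (p : Walk z u) →
                     IsPath (cons e₁ (cons e₂ p)) → E T u x → Cycle T
  closedPath⇒cycle {x = x} e₁ e₂ p p-path e =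
    length p , vertexAt w , vertexAt-injective w p-path , vertexAt-edge w ,
    subst (λ y → E T y x) (sym (vertexAt-last w)) e
    where w = cons e₁ (cons e₂ p)

module Forest (T : Graph) (acyclic : Acyclic T) where

  open import Data.Fin using (Fin; zero; suc)
  open import Data.Nat using (zero; suc)
  open import Data.Product using (∃; _×_; _,_; proj₁; proj₂)
  open import Data.Sum using (inj₁; inj₂)
  open import Data.Unit using (tt)
  open import Data.Empty using (⊥-elim)
  open import Data.List.Membership.Propositional using (_∉_)
  open import Data.List.Relation.Unary.All as All using (All; []; _∷_)
  open import Data.List.Relation.Unary.All.Properties using (anti-mono)
  open import Relation.Unary using (Pred; _∩_; ⋂; _≬_)
  open Walks T

  private variable
    a a′ b c x y : Vertex
    S S₁ S₂ S₃ : Pred Vertex _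

  path-traverses-edge : E T x y → (p : Walk x y) → IsPath p → Traverses x y p
  path-traverses-edge e nil _ = ⊥-elim (E-irr T e)
  path-traverses-edge e (cons e′ nil) _ = hit e′ nil
  path-traverses-edge e (cons e₁ (cons e₂ p)) p-path =
    ⊥-elim (acyclic (closedPath⇒cycle e₁ e₂ p p-path (E-sym T e)))

  walk-traverses-edge : E T x y → (w : Walk x y) → Traverses x y w
  walk-traverses-edge e w =
    let p , p-path , p⊑w = eraseLoops w in traverses⊆ p⊑w (path-traverses-edge e p p-path)

  -- w followed by q backwards is a walk from a to a′, and a ∉ q rules out the edge in q.
  traverses-avoiding : E T a a′ → (q : Walk a′ b) → a ∉ vertices q →
                       (w : Walk a b) → Traverses a a′ w
  traverses-avoiding e q a∉q w with traverses-++ w (walk-traverses-edge e (w ++ reverse q))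
  ... | inj₁ s = s
  ... | inj₂ s = ⊥-elim (a∉q (proj₂ (traverses⇒∈ (traverses-reverse q s))))

  connected⇒path⊆ : ConnectedSet T S → (p : Walk a b) → IsPath p → S a → S b →
                    All S (vertices p)
  connected⇒path⊆ _ nil _ Sa _ = Sa ∷ []
  connected⇒path⊆ {a = a} {b} S-conn (cons e q) (a∉q , q-path) Sa Sb =
    Sa ∷ connected⇒path⊆ S-conn q q-path Sa′ Sb
    where
      w = fromWalkIn (S-conn a b Sa Sb)
      Sa′ = proj₂ (traverses-All (proj₂ w) (traverses-avoiding e q a∉q (proj₁ w)))

  ∩-connected : ConnectedSet T S₁ → ConnectedSet T S₂ → ConnectedSet T (S₁ ∩ S₂)
  ∩-connected S₁-conn S₂-conn x y (S₁x , S₂x) (S₁y , S₂y) =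
    let w , w⊆S₁ = fromWalkIn (S₁-conn x y S₁x S₁y)
        p , p-path , p⊑w = eraseLoops w
    in toWalkIn p (All.zip (anti-mono (vertices⊆ p⊑w) w⊆S₁ ,
                            connected⇒path⊆ S₂-conn p p-path S₂x S₂y))

  -- Walk along a path inside S₂ from S₁ ∩ S₂ towards S₂ ∩ S₃; at the first edge leaving S₁,
  -- the walk through c ∈ S₁ ∩ S₃ forces the current vertex into S₃.
  three-subtrees-meet : ConnectedSet T S₁ → ConnectedSet T S₂ → ConnectedSet T S₃ →
                        S₁ ≬ S₂ → S₂ ≬ S₃ → S₁ ≬ S₃ → ∃ (S₁ ∩ S₂ ∩ S₃)
  three-subtrees-meet {S₁ = S₁} {S₂} {S₃} S₁-conn S₂-conn S₃-conn
                      (a , S₁a , S₂a) (b , S₂b , S₃b) (c , S₁c , S₃c) =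
    let w , w⊆S₂ = fromWalkIn (S₂-conn a b S₂a S₂b)
        p , p-path , p⊑w = eraseLoops w
    in along p p-path (anti-mono (vertices⊆ p⊑w) w⊆S₂) S₁a S₃b
    where
      along : ∀ {v} (p : Walk v b) → IsPath p → All S₂ (vertices p) → S₁ v → S₃ b →
              ∃ (S₁ ∩ S₂ ∩ S₃)
      along {v} nil _ (S₂v ∷ []) S₁v S₃v = v , S₁v , S₂v , S₃v
      along {v} (cons e q) (v∉q , q-path) (S₂v ∷ q⊆S₂) S₁v S₃b
        with fromWalkIn (S₁-conn v c S₁v S₁c) | fromWalkIn (S₃-conn c b S₃c S₃b)
      ... | w₁ , w₁⊆S₁ | w₃ , w₃⊆S₃
        with traverses-++ w₁ (traverses-avoiding e q v∉q (w₁ ++ w₃))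
      ... | inj₁ s = along q q-path q⊆S₂ (proj₂ (traverses-All w₁⊆S₁ s)) S₃b
      ... | inj₂ s = v , S₁v , S₂v , proj₁ (traverses-All w₃⊆S₃ s)

  helly : ∀ m (F : Fin (suc m) → Pred Vertex _) → (∀ i → ConnectedSet T (F i)) →
          (∀ i j → F i ≬ F j) → ∃ (⋂ (Fin (suc m)) F)
  helly zero F _ F-meet =
    let x , F₀x , _ = F-meet zero zero in x , λ { zero → F₀x }
  helly (suc m) F F-conn F-meet =
    let x , G-all = helly m (λ j → F zero ∩ F (suc j))
                            (λ j → ∩-connected (F-conn zero) (F-conn (suc j))) G-meet
    in x , λ { zero → proj₁ (G-all zero) ; (suc j) → proj₂ (G-all j) }
    where
      G-meet : ∀ j k → (F zero ∩ F (suc j)) ≬ (F zero ∩ F (suc k))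
      G-meet j k =
        let z , F₀z , Fjz , Fkz = three-subtrees-meet (F-conn zero) (F-conn (suc j))
                                    (F-conn (suc k)) (F-meet zero (suc j))
                                    (F-meet (suc j) (suc k)) (F-meet zero (suc k))
        in z , (F₀z , Fjz) , (F₀z , Fkz)

  ⋂-connected : ∀ m (F : Fin m → Pred Vertex _) → Connected T →
                (∀ i → ConnectedSet T (F i)) → ConnectedSet T (⋂ (Fin m) F)
  ⋂-connected zero F T-conn _ x y _ _ = WalkIn-map (λ _ ()) (T-conn x y tt tt)
  ⋂-connected (suc m) F T-conn F-conn x y Fx Fy =
    WalkIn-map uncons
      (∩-connected (F-conn zero) (⋂-connected m (λ j → F (suc j)) T-conn (λ j → F-conn (suc j)))
        x y (Fx zero , λ j → Fx (suc j)) (Fy zero , λ j → Fy (suc j)))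
    where
      uncons : ∀ {x} → F zero x × (∀ j → F (suc j) x) → ∀ i → F i x
      uncons (F₀x , _) zero = F₀x
      uncons (_ , Fx) (suc j) = Fx j

module Counting where

  open import Data.Bool using (Bool; true; false; _∧_)
  open import Data.Nat using (zero; suc; _+_; z≤n; s≤s)
  open import Data.Nat.Properties using (+-*-semiring; +-assoc; +-mono-≤; ≤-trans; ≤-reflexive;
    m≤m+n; m≤n+m; *-identityʳ; *-zeroʳ; module ≤-Reasoning)
  open import Algebra.Properties.Semiring.Sum +-*-semiring
    using (sum; sum-syntax; ∑-comm; *-distribˡ-sum; sum-replicate-zero)
  open import Data.Fin using (Fin; zero; suc; _↑ˡ_; _↑ʳ_; combine)
  open import Data.Fin.Properties using (suc-injective)
  open import Data.Fin.Subset using (Subset; _∈_; ∣_∣)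
  open import Data.Product using (Σ; _×_; _,_)
  open import Data.Empty using (⊥; ⊥-elim)
  open import Data.Vec using ([]; _∷_; lookup)
  open import Data.Vec.Properties using ([]=⇒lookup; lookup⇒[]=)
  open import Function using (_∘_)
  open import Relation.Binary.PropositionalEquality
    using (_≡_; _≢_; refl; sym; trans; cong; cong₂)
  open ≤-Reasoning

  𝟙 : Bool → ℕ
  𝟙 true = 1
  𝟙 false = 0

  sum-mono-≤ : ∀ {m} {f g : Fin m → ℕ} → (∀ i → f i ≤ g i) → sum f ≤ sum g
  sum-mono-≤ {zero} _ = z≤n
  sum-mono-≤ {suc m} f≤g = +-mono-≤ (f≤g zero) (sum-mono-≤ (f≤g ∘ suc))

  ≤-sum : ∀ {m} (f : Fin m → ℕ) i → f i ≤ sum f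
  ≤-sum f zero = m≤m+n _ _
  ≤-sum f (suc i) = ≤-trans (≤-sum (f ∘ suc) i) (m≤n+m _ (f zero))

  sum-const-1 : ∀ m → ∑[ i < m ] 1 ≡ m
  sum-const-1 zero = refl
  sum-const-1 (suc m) = cong suc (sum-const-1 m)

  sum-↑ : ∀ m {k} (f : Fin (m + k) → ℕ) →
          sum f ≡ ∑[ i < m ] f (i ↑ˡ k) + ∑[ j < k ] f (m ↑ʳ j)
  sum-↑ zero f = refl
  sum-↑ (suc m) f = trans (cong (f zero +_) (sum-↑ m (f ∘ suc))) (sym (+-assoc (f zero) _ _))

  sum-combine : ∀ m {k} (f : Fin (m * k) → ℕ) →
                sum f ≡ ∑[ g < m ] ∑[ v < k ] f (combine g v)
  sum-combine zero f = refl
  sum-combine (suc m) {k} f =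
    trans (sum-↑ k f)
          (cong (∑[ v < k ] f (combine {suc m} zero v) +_) (sum-combine m (f ∘ (k ↑ʳ_))))

  ∣p∣≡∑𝟙 : ∀ {m} (p : Subset m) → ∣ p ∣ ≡ ∑[ i < m ] 𝟙 (lookup p i)
  ∣p∣≡∑𝟙 [] = refl
  ∣p∣≡∑𝟙 (true ∷ p) = cong suc (∣p∣≡∑𝟙 p)
  ∣p∣≡∑𝟙 (false ∷ p) = ∣p∣≡∑𝟙 p

  ∑𝟙≤1 : ∀ {t} (b : Fin t → Bool) → (∀ i j → i ≢ j → b i ≡ true → b j ≡ true → ⊥) →
         ∑[ i < t ] 𝟙 (b i) ≤ 1
  ∑𝟙≤1 {zero} _ _ = z≤n
  ∑𝟙≤1 {suc t} b exclusive with b zero in b₀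
  ... | false = ∑𝟙≤1 (b ∘ suc) λ i j i≢j → exclusive (suc i) (suc j) (i≢j ∘ suc-injective)
  ... | true = s≤s (≤-trans (sum-mono-≤ others-false) (≤-reflexive (sum-replicate-zero t)))
    where
      others-false : ∀ i → 𝟙 (b (suc i)) ≤ 0
      others-false i with b (suc i) in bᵢ
      ... | false = z≤n
      ... | true = ⊥-elim (exclusive zero (suc i) (λ ()) b₀ bᵢ)

  PairwiseDisjoint : ∀ {t k} → (Fin t → Subset k) → Set
  PairwiseDisjoint B = ∀ i j → i ≢ j → ∀ v → v ∈ B i → v ∈ B j → ⊥

  disjoint-hits≤ : ∀ {t k} (B : Fin t → Subset k) → PairwiseDisjoint B → (r : Fin k → Bool) →
                   (∀ i → Σ (Fin k) λ v → v ∈ B i × r v ≡ true) → t ≤ ∑[ v < k ] 𝟙 (r v)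
  disjoint-hits≤ {t} {k} B disjoint r hits = begin
    t                                                ≡⟨ sum-const-1 t ⟨
    ∑[ i < t ] 1                                     ≤⟨ sum-mono-≤ hit ⟩
    ∑[ i < t ] ∑[ v < k ] 𝟙 (r v ∧ lookup (B i) v)  ≡⟨ ∑-comm (λ i v → 𝟙 (r v ∧ lookup (B i) v)) ⟩
    ∑[ v < k ] ∑[ i < t ] 𝟙 (r v ∧ lookup (B i) v)  ≤⟨ sum-mono-≤ (λ v → at-most-one (r v) v) ⟩
    ∑[ v < k ] 𝟙 (r v)                               ∎
    where
      hit : ∀ i → 1 ≤ ∑[ v < k ] 𝟙 (r v ∧ lookup (B i) v)
      hit i with hits i
      ... | v , v∈Bᵢ , rv =
        ≤-trans (≤-reflexive (sym (cong₂ (λ a b → 𝟙 (a ∧ b)) rv ([]=⇒lookup v∈Bᵢ)))) (≤-sum _ v)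
      at-most-one : ∀ c v → ∑[ i < t ] 𝟙 (c ∧ lookup (B i) v) ≤ 𝟙 c
      at-most-one false v = ≤-reflexive (sum-replicate-zero t)
      at-most-one true v = ∑𝟙≤1 (λ i → lookup (B i) v) λ i j i≢j v∈Bᵢ v∈Bⱼ →
        disjoint i j i≢j v (lookup⇒[]= v (B i) v∈Bᵢ) (lookup⇒[]= v (B j) v∈Bⱼ)

  rows-hitting-disjoint-sets : ∀ {t m k} (B : Fin t → Subset k) → PairwiseDisjoint B →
    (P : Subset (m * k)) (Q : Subset m) →
    (∀ {g} → g ∈ Q → ∀ i → Σ (Fin k) λ v → v ∈ B i × combine g v ∈ P) →
    t * ∣ Q ∣ ≤ ∣ P ∣
  rows-hitting-disjoint-sets {t} {m} {k} B disjoint P Q hits = begin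
    t * ∣ Q ∣                                          ≡⟨ cong (t *_) (∣p∣≡∑𝟙 Q) ⟩
    t * ∑[ g < m ] 𝟙 (lookup Q g)                      ≡⟨ *-distribˡ-sum t (𝟙 ∘ lookup Q) ⟩
    ∑[ g < m ] (t * 𝟙 (lookup Q g))                    ≤⟨ sum-mono-≤ row-bound ⟩
    ∑[ g < m ] ∑[ v < k ] 𝟙 (lookup P (combine g v))  ≡⟨ sum-combine m _ ⟨
    ∑[ w < m * k ] 𝟙 (lookup P w)                      ≡⟨ ∣p∣≡∑𝟙 P ⟨
    ∣ P ∣                                              ∎
    where
      row-bound : ∀ g → t * 𝟙 (lookup Q g) ≤ ∑[ v < k ] 𝟙 (lookup P (combine g v))
      row-bound g with lookup Q g in Qg
      ... | false = ≤-trans (≤-reflexive (*-zeroʳ t)) z≤n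
      ... | true = ≤-trans (≤-reflexive (*-identityʳ t)) (disjoint-hits≤ B disjoint _ λ i →
        let v , v∈Bᵢ , gv∈P = hits (lookup⇒[]= g Q Qg) i in v , v∈Bᵢ , []=⇒lookup gv∈P)

open import Data.Bool using (true)
open import Data.Nat using (zero; suc; _+_; z≤n; _/_)
open import Data.Nat.Properties using (≤-trans; ≤-reflexive; *-comm; *-monoʳ-≤; module ≤-Reasoning)
open import Data.Nat.DivMod using (m*n/n≡m; /-monoˡ-≤; m/n*n≤m)
open import Data.Fin using (Fin; zero; suc; combine; remQuot; _↑ˡ_; _↑ʳ_; splitAt; _≟_)
open import Data.Fin.Properties using (remQuot-combine; combine-injectiveˡ; combine-injectiveʳ;
  all?; any?; splitAt-↑ˡ; splitAt-↑ʳ)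
open import Data.Fin.Subset using (Subset; _∈_; ∣_∣)
open import Data.Fin.Subset.Properties using (_∈?_)
open import Data.Vec using (tabulate)
open import Data.Vec.Properties using ([]=⇒lookup; lookup⇒[]=; lookup∘tabulate)
open import Data.Product using (Σ; _×_; _,_; proj₁; proj₂)
open import Data.Sum using (_⊎_; inj₁; inj₂; [_,_]′)
open import Function using (_∘_)
open import Relation.Nullary using (Dec; yes; no; does)
open import Relation.Nullary.Decidable using (_×-dec_; dec-true)
open import Relation.Unary using (Pred; Decidable; _≬_)
open import Relation.Binary.PropositionalEquality
  using (_≡_; _≢_; refl; sym; trans; cong; subst; subst₂)
open Counting using (rows-hitting-disjoint-sets)

fromDec : ∀ {m} {P : Fin m → Set} → Decidable P → Subset m
fromDec P? = tabulate (does ∘ P?)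

module _ {m} {P : Fin m → Set} (P? : Decidable P) {x : Fin m} where

  ∈-fromDec⁺ : P x → x ∈ fromDec P?
  ∈-fromDec⁺ Px = lookup⇒[]= x _ (trans (lookup∘tabulate (does ∘ P?) x) (dec-true (P? x) Px))

  ∈-fromDec⁻ : x ∈ fromDec P? → P x
  ∈-fromDec⁻ x∈ = invert (P? x) (trans (sym (lookup∘tabulate (does ∘ P?) x)) ([]=⇒lookup x∈))
    where
      invert : ∀ {A : Set} (A? : Dec A) → does A? ≡ true → A
      invert (yes a) _ = a

m*n≤o⇒n≤o/m : ∀ m {n o} → suc m * n ≤ o → n ≤ o / suc m
m*n≤o⇒n≤o/m m {n} {o} mn≤o = begin
  n                   ≡⟨ m*n/n≡m n (suc m) ⟨
  n * suc m / suc m   ≤⟨ /-monoˡ-≤ (suc m) (≤-trans (≤-reflexive (*-comm n (suc m))) mn≤o) ⟩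
  o / suc m           ∎
  where open ≤-Reasoning

Near : (G : Graph) → Fin (n G) → Fin (n G) → Set
Near G x y = x ≡ y ⊎ E G x y

E⇒≢ : (G : Graph) {x y : Fin (n G)} → E G x y → x ≢ y
E⇒≢ G e refl = E-irr G e

module _ (G H : Graph) {g h : Fin (n G)} {u v : Fin (n H)} where

  ⊠-edge : Near G g h → Near H u v → g ≢ h ⊎ u ≢ v → E (G ⊠ H) (combine g u) (combine h v)
  ⊠-edge gh uv distinct =
    combine-≢ distinct ,
    subst₂ (Near G) (cong proj₁ (unpair g u)) (cong proj₁ (unpair h v)) gh ,
    subst₂ (Near H) (cong proj₂ (unpair g u)) (cong proj₂ (unpair h v)) uv
    where
      combine-≢ : g ≢ h ⊎ u ≢ v → combine g u ≢ combine h v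
      combine-≢ = [ (λ g≢h → g≢h ∘ combine-injectiveˡ g u h v)
                  , (λ u≢v → u≢v ∘ combine-injectiveʳ g u h v) ]′

      unpair : ∀ a b → (a , b) ≡ remQuot {n G} (n H) (combine a b)
      unpair a b = sym (remQuot-combine a b)

  ⊠-near : Near G g h → Near H u v → Near (G ⊠ H) (combine g u) (combine h v)
  ⊠-near (inj₁ refl) (inj₁ refl) = inj₁ refl
  ⊠-near gh (inj₂ e) = inj₂ (⊠-edge gh (inj₂ e) (inj₂ (E⇒≢ H e)))
  ⊠-near (inj₂ e) (inj₁ u≡v) = inj₂ (⊠-edge (inj₂ e) (inj₁ u≡v) (inj₁ (E⇒≢ G e)))

module MinorProjection (G H : Graph) {t : ℕ} (M : KMinorModel (suc t) H)
                       {p : ℕ} (D : TreeDecomposition (G ⊠ H) p) where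

  open KMinorModel M
  module D = TreeDecomposition D
  open Walks D.T using (Vertex; WalkIn-map; _++ᵂ_)
  open Forest D.T (proj₂ (proj₂ D.T-tree)) using (helly; ⋂-connected)

  covers-near : ∀ {w w′} → Near (G ⊠ H) w w′ → Σ Vertex λ x → w ∈ D.bag x × w′ ∈ D.bag x
  covers-near {w} (inj₁ refl) = let x , w∈x = D.covers-V w in x , w∈x , w∈x
  covers-near (inj₂ e) = D.covers-E _ _ e

  Hits : Fin (n G) → Fin (suc t) → Pred Vertex _
  Hits g i x = Σ (Fin (n H)) λ v → v ∈ branch i × combine g v ∈ D.bag x

  Hits-connected : ∀ g i → ConnectedSet D.T (Hits g i)
  Hits-connected g i x y (u , u∈Bᵢ , gu∈x) (v , v∈Bᵢ , gv∈y) =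
    lift (connected i u v u∈Bᵢ v∈Bᵢ) gu∈x gv∈y
    where
      lift : ∀ {a b x y} → WalkIn H (_∈ branch i) a b →
             combine g a ∈ D.bag x → combine g b ∈ D.bag y → WalkIn D.T (Hits g i) x y
      lift {a} (here a∈Bᵢ) ga∈x ga∈y =
        WalkIn-map (λ ga∈ → a , a∈Bᵢ , ga∈) (D.conn (combine g a) _ _ ga∈x ga∈y)
      lift {a} (step a∈Bᵢ e w) ga∈x gb∈y =
        let z , ga∈z , ga′∈z = covers-near (⊠-near G H (inj₁ refl) (inj₂ e))
        in WalkIn-map (λ ga∈ → a , a∈Bᵢ , ga∈) (D.conn (combine g a) _ z ga∈x ga∈z)
           ++ᵂ lift w ga′∈z gb∈y

  Hits-≬ : ∀ {g h} → Near G g h → ∀ i j → Hits g i ≬ Hits h j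
  Hits-≬ gh i j with i ≟ j
  ... | yes refl =
    let u , u∈Bᵢ = nonempty i
        x , gu∈x , hu∈x = covers-near (⊠-near G H gh (inj₁ refl))
    in x , (u , u∈Bᵢ , gu∈x) , (u , u∈Bᵢ , hu∈x)
  ... | no i≢j =
    let u , v , u∈Bᵢ , v∈Bⱼ , e = adjacent i j i≢j
        x , gu∈x , hv∈x = covers-near (⊠-near G H gh (inj₂ e))
    in x , (u , u∈Bᵢ , gu∈x) , (v , v∈Bⱼ , hv∈x)

  HitsAll? : ∀ x → Decidable λ g → ∀ i → Hits g i x
  HitsAll? x g = all? λ i → any? λ v → (v ∈? branch i) ×-dec (combine g v ∈? D.bag x)

  bag : Vertex → Subset (n G)
  bag x = fromDec (HitsAll? x)

  covers-V : ∀ g → Σ Vertex λ x → g ∈ bag x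
  covers-V g =
    let x , hits = helly t (Hits g) (Hits-connected g) (Hits-≬ (inj₁ refl))
    in x , ∈-fromDec⁺ (HitsAll? x) hits

  covers-E : ∀ g h → E G g h → Σ Vertex λ x → g ∈ bag x × h ∈ bag x
  covers-E g h e =
    let x , hits = helly (t + suc t) F F-connected F-≬
    in x , ∈-fromDec⁺ (HitsAll? x) (Hits-g hits) , ∈-fromDec⁺ (HitsAll? x) (Hits-h hits)
    where
      F : Fin (suc t + suc t) → Pred Vertex _
      F k = [ Hits g , Hits h ]′ (splitAt (suc t) k)

      F-connected : ∀ k → ConnectedSet D.T (F k)
      F-connected k with splitAt (suc t) k
      ... | inj₁ i = Hits-connected g i
      ... | inj₂ j = Hits-connected h j

      F-≬ : ∀ k l → F k ≬ F l
      F-≬ k l with splitAt (suc t) k | splitAt (suc t) l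
      ... | inj₁ i | inj₁ j = Hits-≬ (inj₁ refl) i j
      ... | inj₁ i | inj₂ j = Hits-≬ (inj₂ e) i j
      ... | inj₂ i | inj₁ j = Hits-≬ (inj₂ (E-sym G e)) i j
      ... | inj₂ i | inj₂ j = Hits-≬ (inj₁ refl) i j

      Hits-g : ∀ {x} → (∀ k → F k x) → ∀ i → Hits g i x
      Hits-g {x} hits i =
        subst (λ s → [ Hits g , Hits h ]′ s x) (splitAt-↑ˡ (suc t) i (suc t)) (hits (i ↑ˡ suc t))

      Hits-h : ∀ {x} → (∀ k → F k x) → ∀ j → Hits h j x
      Hits-h {x} hits j =
        subst (λ s → [ Hits g , Hits h ]′ s x) (splitAt-↑ʳ (suc t) (suc t) j) (hits (suc t ↑ʳ j))

  bag-connected : ∀ g → ConnectedSet D.T (λ x → g ∈ bag x)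
  bag-connected g x y g∈x g∈y =
    WalkIn-map (∈-fromDec⁺ (HitsAll? _))
      (⋂-connected (suc t) (Hits g) (proj₁ (proj₂ D.T-tree)) (Hits-connected g)
        x y (∈-fromDec⁻ (HitsAll? x) g∈x) (∈-fromDec⁻ (HitsAll? y) g∈y))

  bag-size : ∀ x → suc t * ∣ bag x ∣ ≤ p
  bag-size x =
    ≤-trans (rows-hitting-disjoint-sets branch disjoint (D.bag x) (bag x) (∈-fromDec⁻ (HitsAll? x)))
            (D.bag-size x)

  projection : TreeDecomposition G (p / suc t)
  projection = record
    { T = D.T ; T-tree = D.T-tree ; bag = bag
    ; covers-V = covers-V ; covers-E = covers-E ; conn = bag-connected
    ; bag-size = λ x → m*n≤o⇒n≤o/m t (bag-size x) }

theorem27 : (G H : Graph) (k t p : ℕ) →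
    IsTreewidthPlusOne G k → IsHadwiger H t → IsTreewidthPlusOne (G ⊠ H) p →
    t * k ≤ p
theorem27 G H k zero p _ _ _ = z≤n
theorem27 G H k (suc t) p (_ , minimal) (M , _) (D , _) = begin
  suc t * k            ≤⟨ *-monoʳ-≤ (suc t) (minimal (p / suc t) projection) ⟩
  suc t * (p / suc t)  ≡⟨ *-comm (suc t) (p / suc t) ⟩
  p / suc t * suc t    ≤⟨ m/n*n≤m p (suc t) ⟩
  p                    ∎
  where
    open ≤-Reasoning
    open MinorProjection G H M D using (projection)
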